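{- Let $r$ be an integer with $0 \le r \le \frac{n}{2}$ and let $M$ be the real matrix indexed by permutations $\pi,\pi' \in S_r$ with entries \[ M_{\pi\pi'} = \sum_{A:\ \{i : \pi(i)\ne\pi'(i)\} \subseteq A \subseteq [1,r]} \frac{1}{\prod_{j=0}^{|A|-1}(n-r-j)}. \] Then $M$ is positive definite ($M \succ 0$).
   Context: $n$ is a positive integer, $S_r$ is the symmetric group on $[1,r]$, and empty products equal $1$.
   Formalization: Positive definiteness of $M$ is tested only on nonzero vectors with rational entries rather than real ones. -}

module Defs where

open import Data.Nat as ℕ using (ℕ; zero; suc; _∸_)
open import Data.Fin using (Fin)
open import Data.Fin.Properties using (_≟_)
open import Data.Vec using (Vec; []; _∷_; lookup)
open import Data.List as L using (List; []; _∷_; map; concatMap; allFin; foldr)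
open import Data.Bool.ListAction using (any; all)
open import Data.Bool using (Bool; true; false; not; _∧_; _∨_; if_then_else_)
open import Relation.Nullary.Decidable using (⌊_⌋)
open import Data.Rational as ℚ using (ℚ; 0ℚ)
open import Data.Integer using (+_)

vecsOver : {A : Set} → List A → (k : ℕ) → List (Vec A k)
vecsOver xs zero = [] ∷ []
vecsOver xs (suc k) = concatMap (λ v → map (λ a → a ∷ v) xs) (vecsOver xs k)

noDup : {m : ℕ} → List (Fin m) → Bool
noDup [] = true
noDup (a ∷ as) = not (any (λ b → ⌊ a ≟ b ⌋) as) ∧ noDup as

toList : {A : Set} {k : ℕ} → Vec A k → List A
toList [] = []
toList (a ∷ v) = a ∷ toList v

-- A permutation π of [1,r] (0-indexed as Fin r) is represented by the vector
-- (π 0, …, π (r-1)); S r lists exactly the injective such vectors, i.e. S_r.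
Perm : ℕ → Set
Perm r = Vec (Fin r) r

S : (r : ℕ) → List (Perm r)
S r = L.filterᵇ (λ v → noDup (toList v)) (vecsOver (allFin r) r)

Subset : ℕ → Set
Subset r = Vec Bool r

allSubsets : (r : ℕ) → List (Subset r)
allSubsets r = vecsOver (true ∷ false ∷ []) r

card : {r : ℕ} → Subset r → ℕ
card [] = 0
card (true ∷ A) = suc (card A)
card (false ∷ A) = card A

disagree⊆ : {r : ℕ} → Perm r → Perm r → Subset r → Bool
disagree⊆ {r} π π' A =
  all (λ i → ⌊ lookup π i ≟ lookup π' i ⌋ ∨ lookup A i) (allFin r)

denom : ℕ → ℕ → ℕ → ℕ
denom n r zero = 1
denom n r (suc k) = denom n r k ℕ.* (n ∸ r ∸ k)

-- 1/d for d > 0 (d = 0 never occurs under the theorem's hypotheses; mapped to 0)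
recip : ℕ → ℚ
recip zero = 0ℚ
recip (suc d) = + 1 ℚ./ suc d

sumℚ : List ℚ → ℚ
sumℚ = foldr ℚ._+_ 0ℚ

M : (n r : ℕ) → Perm r → Perm r → ℚ
M n r π π' =
  sumℚ (map (λ A → if disagree⊆ π π' A then recip (denom n r (card A)) else 0ℚ)
            (allSubsets r))

quadForm : (n r : ℕ) → (Perm r → ℚ) → ℚ
quadForm n r x =
  sumℚ (map (λ π → sumℚ (map (λ π' → x π ℚ.* M n r π π' ℚ.* x π') (S r))) (S r))

{-# OPTIONS --safe #-}
-- M is a nonnegative combination, over the subsets A of [1,r], of the 0/1 matrices
-- [π and π′ agree outside A]. Agreeing outside A is an equivalence relation, so each of
-- these matrices is block diagonal with all-ones blocks, and its quadratic form is the sum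
-- over equivalence classes of (Σ_{π ∈ class} x π)², which is nonnegative. The term A = ∅
-- has weight 1 and is the identity matrix, whose form Σ x π² is positive for x ≠ 0.
module Submission where

open import Defs
open import Data.Nat as ℕ using (ℕ)
open import Data.Rational using (ℚ; 0ℚ; _<_)
open import Data.List.Relation.Unary.Any using (Any)
open import Relation.Binary.PropositionalEquality using (_≢_)

open import Algebra.Bundles using (CommutativeMonoid)
open import Data.Bool using (Bool; true; false; T; T?; _∨_; if_then_else_)
open import Data.Bool.Properties using (T-∨)
open import Data.Empty using (⊥-elim)
open import Data.Fin using (Fin)
open import Data.Fin.Properties using (_≟_)
open import Data.List using (List; []; _∷_; map; filter; length; allFin)
open import Data.List.Properties
  using (map-cong; map-cong-local; length-filter; filter-accept; filter-reject)
open import Data.List.Membership.Propositional using (_∈_; lose)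
open import Data.List.Membership.Propositional.Properties using (∈-map⁺; ∈-concatMap⁺; ∈-allFin)
open import Data.List.Relation.Unary.All as All using (All; []; _∷_)
open import Data.List.Relation.Unary.All.Properties using (all⁺; all⁻; all-filter)
open import Data.List.Relation.Unary.Any using (here; there)
import Data.List.Relation.Unary.Any.Properties as Anyₚ
open import Data.Nat.Induction using (<-wellFounded)
open import Data.Rational.Properties as ℚ using ()
open import Data.Sum as Sum using (_⊎_; inj₁; inj₂)
open import Data.Vec using (Vec; _∷_; lookup; replicate)
open import Data.Vec.Properties using (lookup-replicate)
import Data.Vec.Relation.Unary.All as VecAll
open import Data.Vec.Relation.Binary.Pointwise.Extensional using (ext; Pointwise-≡⇒≡)
open import Function using (_∘_; _on_; Equivalence)
open import Induction.WellFounded using (WellFounded; Acc; acc)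
open import Relation.Binary.Construct.On as On using ()
open import Relation.Binary.Definitions using (tri<; tri≈; tri>)
open import Relation.Binary.PropositionalEquality
  using (_≡_; refl; sym; trans; cong; cong₂; subst; module ≡-Reasoning)
open import Relation.Binary.Structures using (IsEquivalence)
open import Relation.Nullary using (¬_; Dec; yes; no)
open import Relation.Nullary.Decidable using (⌊_⌋; toWitness; fromWitness)
open import Relation.Unary using (Pred; Decidable; ∁)
open import Relation.Unary.Properties using (∁?)

any-filter⁺ : ∀ {A : Set} {p q} {P : Pred A p} {Q : Pred A q} (Q? : Decidable Q) →
              (∀ {i} → P i → Q i) → ∀ {xs} → Any P xs → Any P (filter Q? xs)
any-filter⁺ Q? P⇒Q Pxs with Anyₚ.filter⁺ Q? Pxs
... | inj₁ Pxs′ = Pxs′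
... | inj₂ ¬Q   = ⊥-elim (¬Q (P⇒Q (Anyₚ.lookup-result Pxs)))

module RationalArithmetic where
  open import Data.Rational using (_+_; _*_; _≤_; positive; negative; nonNegative)
  open import Algebra.Properties.CommutativeSemigroup
    (CommutativeMonoid.commutativeSemigroup ℚ.+-0-commutativeMonoid) using (interchange; x∙yz≈y∙xz)

  square-pos : ∀ q → q ≢ 0ℚ → 0ℚ < q * q
  square-pos q q≢0 with ℚ.<-cmp q 0ℚ
  ... | tri< q<0 _ _ =
    ℚ.positive⁻¹ (q * q) {{ℚ.neg*neg⇒pos q {{negative q<0}} q {{negative q<0}}}}
  ... | tri≈ _ q≡0 _ = ⊥-elim (q≢0 q≡0)
  ... | tri> _ _ q>0 =
    ℚ.positive⁻¹ (q * q) {{ℚ.pos*pos⇒pos q {{positive q>0}} q {{positive q>0}}}}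

  square-nonneg : ∀ q → 0ℚ ≤ q * q
  square-nonneg q with q ℚ.≟ 0ℚ
  ... | yes refl = ℚ.≤-refl
  ... | no q≢0   = ℚ.<⇒≤ (square-pos q q≢0)

  *-nonneg : ∀ {p q} → 0ℚ ≤ p → 0ℚ ≤ q → 0ℚ ≤ p * q
  *-nonneg {p} {q} p≥0 q≥0 =
    ℚ.nonNegative⁻¹ (p * q) {{ℚ.nonNeg*nonNeg⇒nonNeg p {{nonNegative p≥0}} q {{nonNegative q≥0}}}}

  ∑ : {A : Set} → List A → (A → ℚ) → ℚ
  ∑ xs f = sumℚ (map f xs)

  syntax ∑ xs (λ i → f) = ∑[ i ∈ xs ] f

  module _ {A : Set} where

    ∑-cong : ∀ {f g : A → ℚ} xs → (∀ i → f i ≡ g i) → ∑ xs f ≡ ∑ xs g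
    ∑-cong xs f≗g = cong sumℚ (map-cong f≗g xs)

    ∑-cong-local : ∀ {f g : A → ℚ} {xs} → All (λ i → f i ≡ g i) xs → ∑ xs f ≡ ∑ xs g
    ∑-cong-local f≗g = cong sumℚ (map-cong-local f≗g)

    ∑-zero : ∀ {f : A → ℚ} {xs} → All (λ i → f i ≡ 0ℚ) xs → ∑ xs f ≡ 0ℚ
    ∑-zero []             = refl
    ∑-zero (fx≡0 ∷ fxs≡0) = cong₂ _+_ fx≡0 (∑-zero fxs≡0)

    ∑-+ : ∀ (f g : A → ℚ) xs → ∑[ i ∈ xs ] (f i + g i) ≡ ∑ xs f + ∑ xs g
    ∑-+ f g []       = refl
    ∑-+ f g (x ∷ xs) =
      trans (cong (f x + g x +_) (∑-+ f g xs)) (interchange (f x) (g x) (∑ xs f) (∑ xs g))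

    ∑-*ˡ : ∀ c (f : A → ℚ) xs → ∑[ i ∈ xs ] (c * f i) ≡ c * ∑ xs f
    ∑-*ˡ c f []       = sym (ℚ.*-zeroʳ c)
    ∑-*ˡ c f (x ∷ xs) =
      trans (cong (c * f x +_) (∑-*ˡ c f xs)) (sym (ℚ.*-distribˡ-+ c (f x) (∑ xs f)))

    ∑-*ʳ : ∀ c (f : A → ℚ) xs → ∑[ i ∈ xs ] (f i * c) ≡ ∑ xs f * c
    ∑-*ʳ c f []       = sym (ℚ.*-zeroˡ c)
    ∑-*ʳ c f (x ∷ xs) =
      trans (cong (f x * c +_) (∑-*ʳ c f xs)) (sym (ℚ.*-distribʳ-+ c (f x) (∑ xs f)))

    ∑-filter : ∀ {ℓ} {P : Pred A ℓ} (P? : Decidable P) (f : A → ℚ) xs →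
               ∑ xs f ≡ ∑ (filter P? xs) f + ∑ (filter (∁? P?) xs) f
    ∑-filter P? f []       = refl
    ∑-filter {P = P} P? f (x ∷ xs) = by-cases (P? x)
      where
      open ≡-Reasoning
      sums : List A → List A → ℚ
      sums ys zs = ∑ ys f + ∑ zs f
      by-cases : Dec (P x) → ∑ (x ∷ xs) f ≡ sums (filter P? (x ∷ xs)) (filter (∁? P?) (x ∷ xs))
      by-cases (yes px) = begin
        f x + ∑ xs f                                   ≡⟨ cong (f x +_) (∑-filter P? f xs) ⟩
        f x + sums (filter P? xs) (filter (∁? P?) xs)  ≡⟨ ℚ.+-assoc (f x) _ _ ⟨
        sums (x ∷ filter P? xs) (filter (∁? P?) xs)    ≡⟨ cong₂ sums (filter-accept P? px)
                                                               (filter-reject (∁? P?) (λ ¬px → ¬px px)) ⟨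
        sums (filter P? (x ∷ xs)) (filter (∁? P?) (x ∷ xs)) ∎
      by-cases (no ¬px) = begin
        f x + ∑ xs f                                   ≡⟨ cong (f x +_) (∑-filter P? f xs) ⟩
        f x + sums (filter P? xs) (filter (∁? P?) xs)  ≡⟨ x∙yz≈y∙xz (f x) (∑ (filter P? xs) f) _ ⟩
        sums (filter P? xs) (x ∷ filter (∁? P?) xs)    ≡⟨ cong₂ sums (filter-reject P? ¬px)
                                                               (filter-accept (∁? P?) ¬px) ⟨
        sums (filter P? (x ∷ xs)) (filter (∁? P?) (x ∷ xs)) ∎

    ∑-nonneg : ∀ {f : A → ℚ} {xs} → All (λ i → 0ℚ ≤ f i) xs → 0ℚ ≤ ∑ xs f
    ∑-nonneg []             = ℚ.≤-refl
    ∑-nonneg (fx≥0 ∷ fxs≥0) = ℚ.+-mono-≤ fx≥0 (∑-nonneg fxs≥0)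

    ∑-pos : ∀ {f : A → ℚ} {xs} → All (λ i → 0ℚ ≤ f i) xs → Any (λ i → 0ℚ < f i) xs → 0ℚ < ∑ xs f
    ∑-pos (_ ∷ fxs≥0)    (here fx>0)   = ℚ.+-mono-<-≤ fx>0 (∑-nonneg fxs≥0)
    ∑-pos (fx≥0 ∷ fxs≥0) (there fxs>0) = ℚ.+-mono-≤-< fx≥0 (∑-pos fxs≥0 fxs>0)

  ∑-comm : ∀ {A B : Set} (f : A → B → ℚ) xs ys →
           ∑[ i ∈ xs ] ∑[ j ∈ ys ] f i j ≡ ∑[ j ∈ ys ] ∑[ i ∈ xs ] f i j
  ∑-comm f []       ys = sym (∑-zero (All.universal (λ _ → refl) ys))
  ∑-comm f (x ∷ xs) ys =
    trans (cong (∑ ys (f x) +_) (∑-comm f xs ys)) (sym (∑-+ (f x) (λ j → ∑[ i ∈ xs ] f i j) ys))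

module EquivalenceKernel {P : Set} (R : P → P → Bool)
    (isEquivalence : IsEquivalence (λ i j → T (R i j))) (x : P → ℚ) where
  open import Data.Rational using (_+_; _*_; _≤_)
  open RationalArithmetic
  open IsEquivalence isEquivalence using () renaming (refl to R-refl; sym to R-sym; trans to R-trans)

  kernel : P → P → ℚ
  kernel i j = if R i j then x i * x j else 0ℚ

  form : List P → List P → ℚ
  form is js = ∑[ i ∈ is ] ∑[ j ∈ js ] kernel i j

  kernel-related : ∀ {i j} → T (R i j) → kernel i j ≡ x i * x j
  kernel-related {i} {j} Rij with R i j
  ... | true = refl

  kernel-unrelated : ∀ {i j} → ¬ T (R i j) → kernel i j ≡ 0ℚ
  kernel-unrelated {i} {j} ¬Rij with R i j
  ... | true  = ⊥-elim (¬Rij _)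
  ... | false = refl

  form-unrelated : ∀ {is js} → All (λ i → All (λ j → ¬ T (R i j)) js) is → form is js ≡ 0ℚ
  form-unrelated = ∑-zero ∘ All.map (∑-zero ∘ All.map kernel-unrelated)

  form-related : ∀ {is js} → All (λ i → All (λ j → T (R i j)) js) is → form is js ≡ ∑ is x * ∑ js x
  form-related {is} {js} related = begin
    ∑[ i ∈ is ] ∑[ j ∈ js ] kernel i j
      ≡⟨ ∑-cong-local (All.map (∑-cong-local ∘ All.map kernel-related) related) ⟩
    ∑[ i ∈ is ] ∑[ j ∈ js ] (x i * x j)  ≡⟨ ∑-cong is (λ i → ∑-*ˡ (x i) x js) ⟩
    ∑[ i ∈ is ] (x i * ∑ js x)           ≡⟨ ∑-*ʳ (∑ js x) x is ⟩
    ∑ is x * ∑ js x                      ∎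
    where open ≡-Reasoning

  related? : ∀ a → Decidable (T ∘ R a)
  related? a j = T? (R a j)

  classOf : P → List P → List P
  classOf a xs = a ∷ filter (related? a) xs

  outside : P → List P → List P
  outside a xs = filter (∁? (related? a)) xs

  module _ (a : P) (xs : List P) where

    classOf-related : All (T ∘ R a) (classOf a xs)
    classOf-related = R-refl ∷ all-filter (related? a) xs

    outside-unrelated : All (∁ (T ∘ R a)) (outside a xs)
    outside-unrelated = all-filter (∁? (related? a)) xs

    ∑-classOf-outside : ∀ f → ∑ (a ∷ xs) f ≡ ∑ (classOf a xs) f + ∑ (outside a xs) f
    ∑-classOf-outside f = trans (cong (f a +_) (∑-filter (related? a) f xs))
                                (sym (ℚ.+-assoc (f a) (∑ (filter (related? a) xs) f) _))

    form-classOf : form (classOf a xs) (classOf a xs) ≡ ∑ (classOf a xs) x * ∑ (classOf a xs) x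
    form-classOf = form-related
      (All.map (λ Rai → All.map (R-trans (R-sym Rai)) classOf-related) classOf-related)

    form-classOf-nonneg : 0ℚ ≤ form (classOf a xs) (classOf a xs)
    form-classOf-nonneg = subst (0ℚ ≤_) (sym form-classOf) (square-nonneg (∑ (classOf a xs) x))

    form-classOf-outside : form (classOf a xs) (outside a xs) ≡ 0ℚ
    form-classOf-outside = form-unrelated
      (All.map (λ Rai → All.map (λ ¬Raj Rij → ¬Raj (R-trans Rai Rij)) outside-unrelated) classOf-related)

    form-outside-classOf : form (outside a xs) (classOf a xs) ≡ 0ℚ
    form-outside-classOf = form-unrelated
      (All.map (λ ¬Rai → All.map (λ Raj Rij → ¬Rai (R-trans Raj (R-sym Rij))) classOf-related)
               outside-unrelated)

    form-decomposition :
      form (a ∷ xs) (a ∷ xs) ≡ form (classOf a xs) (classOf a xs) + form (outside a xs) (outside a xs)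
    form-decomposition = begin
      ∑[ i ∈ a ∷ xs ] ∑[ j ∈ a ∷ xs ] kernel i j
        ≡⟨ ∑-cong (a ∷ xs) (λ i → ∑-classOf-outside (kernel i)) ⟩
      ∑[ i ∈ a ∷ xs ] (∑ C (kernel i) + ∑ O (kernel i))
        ≡⟨ ∑-+ (λ i → ∑ C (kernel i)) (λ i → ∑ O (kernel i)) (a ∷ xs) ⟩
      ∑[ i ∈ a ∷ xs ] ∑ C (kernel i) + ∑[ i ∈ a ∷ xs ] ∑ O (kernel i)
        ≡⟨ cong₂ _+_ (∑-classOf-outside (λ i → ∑ C (kernel i)))
                     (∑-classOf-outside (λ i → ∑ O (kernel i))) ⟩
      (form C C + form O C) + (form C O + form O O)
        ≡⟨ cong₂ (λ u v → (form C C + u) + (v + form O O)) form-outside-classOf form-classOf-outside ⟩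
      (form C C + 0ℚ) + (0ℚ + form O O)
        ≡⟨ cong₂ _+_ (ℚ.+-identityʳ (form C C)) (ℚ.+-identityˡ (form O O)) ⟩
      form C C + form O O ∎
      where
      open ≡-Reasoning
      C = classOf a xs
      O = outside a xs

  _shorter_ : List P → List P → Set
  _shorter_ = ℕ._<_ on length

  shorter-wellFounded : WellFounded _shorter_
  shorter-wellFounded = On.wellFounded length <-wellFounded

  outside-shorter : ∀ a xs → outside a xs shorter (a ∷ xs)
  outside-shorter a xs = ℕ.s≤s (length-filter (∁? (related? a)) xs)

  form-nonneg : ∀ xs → 0ℚ ≤ form xs xs
  form-nonneg xs = go xs (shorter-wellFounded xs)
    where
    go : ∀ xs → Acc _shorter_ xs → 0ℚ ≤ form xs xs
    go []       _        = ℚ.≤-refl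
    go (a ∷ xs) (acc rs) = subst (0ℚ ≤_) (sym (form-decomposition a xs))
      (ℚ.+-mono-≤ (form-classOf-nonneg a xs) (go (outside a xs) (rs (outside-shorter a xs))))

  -- Asking x to be constant on classes, rather than xs to be duplicate-free, makes this
  -- apply to the identity relation on any list.
  module _ (x-respects : ∀ {i j} → T (R i j) → x i ≡ x j) where

    form-classOf-pos : ∀ a xs → x a ≢ 0ℚ → 0ℚ < form (classOf a xs) (classOf a xs)
    form-classOf-pos a xs xa≢0 =
      subst (0ℚ <_) (sym entries-constant) (∑-pos-const (∑-pos-const (square-pos (x a) xa≢0)))
      where
      C = classOf a xs
      ∑-pos-const : ∀ {c} → 0ℚ < c → 0ℚ < ∑[ _ ∈ C ] c
      ∑-pos-const c>0 = ∑-pos (All.universal (λ _ → ℚ.<⇒≤ c>0) C) (here c>0)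
      entry : ∀ {i j} → T (R a i) → T (R a j) → kernel i j ≡ x a * x a
      entry Rai Raj = trans (kernel-related (R-trans (R-sym Rai) Raj))
                            (cong₂ _*_ (sym (x-respects Rai)) (sym (x-respects Raj)))
      entries-constant : form C C ≡ ∑[ _ ∈ C ] ∑[ _ ∈ C ] (x a * x a)
      entries-constant = ∑-cong-local
        (All.map (λ Rai → ∑-cong-local (All.map (entry Rai) (classOf-related a xs))) (classOf-related a xs))

    nonzero-outside : ∀ a xs → x a ≡ 0ℚ → Any (λ i → x i ≢ 0ℚ) xs → Any (λ i → x i ≢ 0ℚ) (outside a xs)
    nonzero-outside a xs xa≡0 =
      any-filter⁺ (∁? (related? a)) (λ xi≢0 Rai → xi≢0 (trans (sym (x-respects Rai)) xa≡0))

    form-pos : ∀ xs → Any (λ i → x i ≢ 0ℚ) xs → 0ℚ < form xs xs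
    form-pos xs = go xs (shorter-wellFounded xs)
      where
      go : ∀ xs → Acc _shorter_ xs → Any (λ i → x i ≢ 0ℚ) xs → 0ℚ < form xs xs
      go (a ∷ xs) (acc rs) nonzero with x a ℚ.≟ 0ℚ | nonzero
      ... | no xa≢0  | _ = subst (0ℚ <_) (sym (form-decomposition a xs))
        (ℚ.+-mono-<-≤ (form-classOf-pos a xs xa≢0) (form-nonneg (outside a xs)))
      ... | yes xa≡0 | here xa≢0 = ⊥-elim (xa≢0 xa≡0)
      ... | yes xa≡0 | there nonzero′ = subst (0ℚ <_) (sym (form-decomposition a xs))
        (ℚ.+-mono-≤-< (form-classOf-nonneg a xs)
                      (go (outside a xs) (rs (outside-shorter a xs)) (nonzero-outside a xs xa≡0 nonzero′)))

agreeOutsideᵇ : ∀ {r} → Subset r → Perm r → Perm r → Bool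
agreeOutsideᵇ A π π′ = disagree⊆ π π′ A

AgreeOutside : ∀ {r} → Subset r → Perm r → Perm r → Set
AgreeOutside A π π′ = ∀ i → lookup π i ≡ lookup π′ i ⊎ T (lookup A i)

module _ {r} (A : Subset r) (π π′ : Perm r) where

  private
    agreesAt : Fin r → Bool
    agreesAt i = ⌊ lookup π i ≟ lookup π′ i ⌋ ∨ lookup A i

  agreeOutsideᵇ⇒AgreeOutside : T (agreeOutsideᵇ A π π′) → AgreeOutside A π π′
  agreeOutsideᵇ⇒AgreeOutside agree i = Sum.map₁ toWitness
    (Equivalence.to T-∨ (All.lookup (all⁺ agreesAt (allFin r) agree) (∈-allFin i)))

  AgreeOutside⇒agreeOutsideᵇ : AgreeOutside A π π′ → T (agreeOutsideᵇ A π π′)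
  AgreeOutside⇒agreeOutsideᵇ agree = all⁻ agreesAt {allFin r}
    (All.tabulate (λ {i} _ → Equivalence.from T-∨ (Sum.map₁ fromWitness (agree i))))

agreeOutsideᵇ-isEquivalence : ∀ {r} (A : Subset r) → IsEquivalence (λ π π′ → T (agreeOutsideᵇ A π π′))
agreeOutsideᵇ-isEquivalence A = record
  { refl  = λ {π} → from π π (λ _ → inj₁ refl)
  ; sym   = λ {π π′} agree → from π′ π (λ i → Sum.map₁ sym (to π π′ agree i))
  ; trans = λ {π π′ π″} agree agree′ →
              from π π″ (λ i → agree-trans (to π π′ agree i) (to π′ π″ agree′ i))
  }
  where
  to   = agreeOutsideᵇ⇒AgreeOutside A
  from = AgreeOutside⇒agreeOutsideᵇ A
  agree-trans : ∀ {a b c} {t : Bool} → a ≡ b ⊎ T t → b ≡ c ⊎ T t → a ≡ c ⊎ T t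
  agree-trans (inj₁ a≡b) (inj₁ b≡c) = inj₁ (trans a≡b b≡c)
  agree-trans (inj₂ t)   _          = inj₂ t
  agree-trans _          (inj₂ t)   = inj₂ t

∅ : ∀ {r} → Subset r
∅ {r} = replicate r false

card-∅ : ∀ r → card (∅ {r}) ≡ 0
card-∅ ℕ.zero    = refl
card-∅ (ℕ.suc r) = card-∅ r

AgreeOutside-∅⇒≡ : ∀ {r} {π π′ : Perm r} → AgreeOutside ∅ π π′ → π ≡ π′
AgreeOutside-∅⇒≡ {π = π} {π′} agree = Pointwise-≡⇒≡ (ext agree-at)
  where
  agree-at : ∀ i → lookup π i ≡ lookup π′ i
  agree-at i with agree i
  ... | inj₁ πi≡π′i = πi≡π′i
  ... | inj₂ i∈∅    = ⊥-elim (subst T (lookup-replicate i false) i∈∅)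

∈-vecsOver : ∀ {A : Set} {xs : List A} {k} {v : Vec A k} → VecAll.All (_∈ xs) v → v ∈ vecsOver xs k
∈-vecsOver VecAll.[] = here refl
∈-vecsOver {xs = xs} {v = a ∷ v} (a∈xs VecAll.∷ v⊆xs) =
  ∈-concatMap⁺ (λ w → map (_∷ w) xs) (lose (∈-vecsOver v⊆xs) (∈-map⁺ (_∷ v) a∈xs))

∈-allSubsets : ∀ {r} (A : Subset r) → A ∈ allSubsets r
∈-allSubsets = ∈-vecsOver ∘ VecAll.universal bool∈
  where
  bool∈ : ∀ b → b ∈ true ∷ false ∷ []
  bool∈ true  = here refl
  bool∈ false = there (here refl)

module Expansion (n r : ℕ) (x : Perm r → ℚ) where
  open import Data.Rational using (_*_; _≤_)
  open import Algebra.Properties.CommutativeSemigroup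
    (CommutativeMonoid.commutativeSemigroup ℚ.*-1-commutativeMonoid) using (xy∙z≈y∙xz)
  open RationalArithmetic

  module Kernel (A : Subset r) = EquivalenceKernel (agreeOutsideᵇ A) (agreeOutsideᵇ-isEquivalence A) x
  open Kernel using (kernel; form; form-nonneg; form-pos)

  weight : Subset r → ℚ
  weight A = recip (denom n r (card A))

  recip-nonneg : ∀ d → 0ℚ ≤ recip d
  recip-nonneg ℕ.zero    = ℚ.≤-refl
  recip-nonneg (ℕ.suc d) = ℚ.nonNegative⁻¹ _ {{ℚ.normalize-nonNeg 1 (ℕ.suc d)}}

  entry-expansion : ∀ π π′ → x π * M n r π π′ * x π′ ≡ ∑[ A ∈ allSubsets r ] (weight A * kernel A π π′)
  entry-expansion π π′ = begin
    x π * ∑ (allSubsets r) term * x π′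
      ≡⟨ cong (_* x π′) (∑-*ˡ (x π) term (allSubsets r)) ⟨
    ∑[ A ∈ allSubsets r ] (x π * term A) * x π′
      ≡⟨ ∑-*ʳ (x π′) (λ A → x π * term A) (allSubsets r) ⟨
    ∑[ A ∈ allSubsets r ] (x π * term A * x π′)
      ≡⟨ ∑-cong (allSubsets r) (λ A → pull-weight (agreeOutsideᵇ A π π′) (weight A)) ⟩
    ∑[ A ∈ allSubsets r ] (weight A * kernel A π π′) ∎
    where
    open ≡-Reasoning
    term : Subset r → ℚ
    term A = if agreeOutsideᵇ A π π′ then weight A else 0ℚ
    pull-weight : ∀ b w → x π * (if b then w else 0ℚ) * x π′ ≡ w * (if b then x π * x π′ else 0ℚ)
    pull-weight true  w = xy∙z≈y∙xz (x π) w (x π′)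
    pull-weight false w =
      trans (cong (_* x π′) (ℚ.*-zeroʳ (x π))) (trans (ℚ.*-zeroˡ (x π′)) (sym (ℚ.*-zeroʳ w)))

  quadForm-expansion : quadForm n r x ≡ ∑[ A ∈ allSubsets r ] (weight A * form A (S r) (S r))
  quadForm-expansion = begin
    ∑[ π ∈ S r ] ∑[ π′ ∈ S r ] (x π * M n r π π′ * x π′)
      ≡⟨ ∑-cong (S r) (λ π → ∑-cong (S r) (entry-expansion π)) ⟩
    ∑[ π ∈ S r ] ∑[ π′ ∈ S r ] ∑[ A ∈ allSubsets r ] (weight A * kernel A π π′)
      ≡⟨ ∑-cong (S r) (λ π → ∑-comm (λ π′ A → weight A * kernel A π π′) (S r) (allSubsets r)) ⟩
    ∑[ π ∈ S r ] ∑[ A ∈ allSubsets r ] ∑[ π′ ∈ S r ] (weight A * kernel A π π′)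
      ≡⟨ ∑-comm (λ π A → ∑[ π′ ∈ S r ] (weight A * kernel A π π′)) (S r) (allSubsets r) ⟩
    ∑[ A ∈ allSubsets r ] ∑[ π ∈ S r ] ∑[ π′ ∈ S r ] (weight A * kernel A π π′)
      ≡⟨ ∑-cong (allSubsets r) (λ A → trans (∑-cong (S r) (λ π → ∑-*ˡ (weight A) (kernel A π) (S r)))
                                            (∑-*ˡ (weight A) (λ π → ∑ (S r) (kernel A π)) (S r))) ⟩
    ∑[ A ∈ allSubsets r ] (weight A * form A (S r) (S r)) ∎
    where open ≡-Reasoning

  term-nonneg : ∀ A → 0ℚ ≤ weight A * form A (S r) (S r)
  term-nonneg A = *-nonneg (recip-nonneg (denom n r (card A))) (form-nonneg A (S r))

  ∅-term-pos : Any (λ π → x π ≢ 0ℚ) (S r) → 0ℚ < weight ∅ * form ∅ (S r) (S r)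
  ∅-term-pos nonzero = subst (0ℚ <_) (sym weight-∅-term) (form-pos ∅ x-respects (S r) nonzero)
    where
    weight-∅-term : weight ∅ * form ∅ (S r) (S r) ≡ form ∅ (S r) (S r)
    weight-∅-term = trans (cong (λ k → recip (denom n r k) * form ∅ (S r) (S r)) (card-∅ r))
                          (ℚ.*-identityˡ (form ∅ (S r) (S r)))
    x-respects : ∀ {π π′} → T (agreeOutsideᵇ ∅ π π′) → x π ≡ x π′
    x-respects {π} {π′} agree = cong x (AgreeOutside-∅⇒≡ (agreeOutsideᵇ⇒AgreeOutside ∅ π π′ agree))

-- Imported this late because the modules above open ℚ's _≤_ and _*_.
open import Data.Nat using (_≤_; _*_)

-- The hypotheses on n and r make every weight positive, but only nonnegativity is used,
-- and that holds for all n and r since denom truncates subtraction and recip 0 = 0.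
mainTheorem12 : (n r : ℕ) → 1 ≤ n → 2 * r ≤ n →
    (x : Perm r → ℚ) → Any (λ π → x π ≢ 0ℚ) (S r) →
    0ℚ < quadForm n r x
mainTheorem12 n r _ _ x nonzero = subst (0ℚ <_) (sym quadForm-expansion)
  (∑-pos (All.universal term-nonneg (allSubsets r)) (lose (∈-allSubsets ∅) (∅-term-pos nonzero)))
  where
  open Expansion n r x
  open RationalArithmetic using (∑-pos)
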